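{- Let $b=(b(n))_{n\ge0}$ be a sequence of elements of $\mathbb{Q}[[q]]$ and let $m,l\in\mathbb{N}$. Then, in $\mathbb{Q}((q))$, \[ \sum_{n=0}^{m}\nabla_q(b)(l+n)\,B_n(q^m)=q^{ -lm}\sum_{j=0}^{l}q^{j}\frac{(q^{ -l})_j}{(q)_j}\,b(j+m). \] In particular, $\sum_{n=0}^{m}\nabla_q(b)(n)\,B_n(q^m)=b(m)$.
   Context: $\mathbb{N}$ denotes the non-negative integers. For $x$ and $n\in\mathbb{N}$, $(x)_n=\prod_{j=0}^{n-1}(1-xq^j)$ (with $(x)_0=1$). For a sequence $b$ in $\mathbb{Q}[[q]]$, define $\nabla_q(b)(n)=\sum_{i=0}^{n}q^{i}\frac{(q^{ -n})_i}{(q)_i}\,b(i)\in\mathbb{Q}((q))$. Define polynomials $B_0(z)=1$ and $B_n(z)=z^n\frac{(z^{ -1})_n}{(q)_n}=\prod_{j=1}^{n}\frac{z-q^{j-1}}{1-q^j}$ for $n\ge1$. -}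

module Defs where

open import Data.Nat as ℕ using (ℕ; zero; suc; _∸_; _<ᵇ_; _≡ᵇ_)
open import Data.Nat.DivMod using (_%_)
open import Data.Integer as ℤ using (ℤ; +_; -[1+_])
open import Data.Rational as ℚ using (ℚ; 0ℚ; 1ℚ)
open import Data.Bool using (if_then_else_)
open import Relation.Binary.PropositionalEquality using (_≡_)

-- Formal power series ℚ[[q]] : coefficient sequences

PS : Set
PS = ℕ → ℚ

1ₚ : PS
1ₚ zero    = 1ℚ
1ₚ (suc _) = 0ℚ

_+ₚ_ : PS → PS → PS
(f +ₚ g) n = f n ℚ.+ g n

sumTo : (ℕ → ℚ) → ℕ → ℚ
sumTo h zero    = h zero
sumTo h (suc n) = sumTo h n ℚ.+ h (suc n)

_*ₚ_ : PS → PS → PS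
(f *ₚ g) n = sumTo (λ k → f k ℚ.* g (n ∸ k)) n

-- multiplication by q^s
shiftₚ : ℕ → PS → PS
shiftₚ s f N = if N <ᵇ s then 0ℚ else f (N ∸ s)

-- the power series 1/(1 - q^(suc j)) = Σ_k q^(k (suc j))
geomInv : ℕ → PS
geomInv j N = if (N % suc j) ≡ᵇ 0 then 1ℚ else 0ℚ

-- 1/(q)_i = Π_{j=1}^{i} 1/(1 - q^j)  as a power series
invqPoch : ℕ → PS
invqPoch zero    = 1ₚ
invqPoch (suc i) = invqPoch i *ₚ geomInv i

-- Laurent series ℚ((q)) : a pair (d , f) represents q^(-d) · f

record Laurent : Set where
  constructor laurent
  field
    den : ℕ
    ser : PS
open Laurent public

-- equality of Laurent series: q^(-d) f = q^(-d') g  iff  q^d' f = q^d g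
_≈L_ : Laurent → Laurent → Set
x ≈L y = ∀ N → shiftₚ (den y) (ser x) N ≡ shiftₚ (den x) (ser y) N

infix 4 _≈L_
infixl 6 _+L_ _-L_
infixl 7 _*L_

fromPS : PS → Laurent
fromPS f = laurent 0 f

1L : Laurent
1L = fromPS 1ₚ

_+L_ : Laurent → Laurent → Laurent
laurent d f +L laurent e g = laurent (d ℕ.+ e) (shiftₚ e f +ₚ shiftₚ d g)

-L_ : Laurent → Laurent
-L laurent d f = laurent d (λ n → ℚ.- f n)

_-L_ : Laurent → Laurent → Laurent
x -L y = x +L (-L y)

_*L_ : Laurent → Laurent → Laurent
laurent d f *L laurent e g = laurent (d ℕ.+ e) (f *ₚ g)

qpow : ℤ → Laurent
qpow (+ n)    = laurent 0 (shiftₚ n 1ₚ)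
qpow -[1+ n ] = laurent (suc n) 1ₚ

sumL : (ℕ → Laurent) → ℕ → Laurent
sumL f zero    = f zero
sumL f (suc n) = sumL f n +L f (suc n)

poch : Laurent → ℕ → Laurent
poch x zero    = 1L
poch x (suc n) = poch x n *L (1L -L x *L qpow (+ n))

nabla : (ℕ → PS) → ℕ → Laurent
nabla b n = sumL (λ i → qpow (+ i) *L poch (qpow (ℤ.- (+ n))) i
                         *L fromPS (invqPoch i) *L fromPS (b i)) n

Bnum : ℕ → Laurent → Laurent
Bnum zero    z = 1L
Bnum (suc n) z = Bnum n z *L (z -L qpow (+ n))

B : ℕ → Laurent → Laurent
B n z = Bnum n z *L fromPS (invqPoch n)

module Submission where

-- For c : ℕ → ℚ((q)) write  Bsum c m l = Σ_{n=0}^{m} c(l+n) B_n(q^m).  Two q-identities drive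
-- an induction on m:
--   (A) from B_{n+1}(qz) = B_{n+1}(z) − z B_n(z) and B_{m+1}(q^m) = 0,
--         Bsum c (m+1) l = Bsum c m l − q^m · Bsum c m (l+1);
--   (B) from (q^{-l})_{l+1} = 0, (y)_{i+1} = (1 − y)(yq)_i and (1 − q^{i+1})/(q)_{i+1} = 1/(q)_i,
--         q^l · (∇b(l) − ∇b(l+1)) = ∇(b ∘ suc)(l).
-- Together they give  q^{lm} · Bsum (∇b) m l = ∇(b(· + m))(l)  by induction on m, which is the
-- first claim after multiplying by q^{-lm}; the second is the case l = 0, where ∇b'(0) = b'(0).

open import Defs
open import Data.Nat using (ℕ; _+_; _*_)
open import Data.Integer using (+_; -_)
open import Data.Product using (_×_)

open import Data.Product using (_,_)
open import Data.Nat as N using (zero; suc; _∸_; _≤_; z≤n; _<ᵇ_)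
import Data.Nat.Properties as NP
open import Data.Nat.DivMod using (_%_; m<n⇒m%n≡m; [m+n]%n≡m%n)
import Data.Rational as Q
import Data.Rational.Properties as QP
open import Data.Maybe using (Maybe; just; nothing)
open import Data.Bool using (true; false; T; if_then_else_)
open import Data.Unit using (tt)
open import Relation.Nullary using (yes; no)
open import Relation.Binary.PropositionalEquality
open import Relation.Binary.Bundles using (Setoid)
import Relation.Binary.Reasoning.Setoid as SetoidReasoning
open import Algebra.Bundles using (CommutativeRing; RawRing)
open import Data.Nat.Tactic.RingSolver using () renaming (solve-∀ to ℕ-solve)
open import Tactic.RingSolver using (solve-∀)
open import Tactic.RingSolver.Core.AlmostCommutativeRing using (AlmostCommutativeRing; fromCommutativeRing)
import Algebra.Solver.Ring.AlmostCommutativeRing as ACR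

ℚ-ring : AlmostCommutativeRing _ _
ℚ-ring = fromCommutativeRing QP.+-*-commutativeRing (λ _ → nothing)

sumTo-cong : ∀ {h h' : ℕ → Q.ℚ} n → (∀ k → k ≤ n → h k ≡ h' k) → sumTo h n ≡ sumTo h' n
sumTo-cong zero    e = e 0 z≤n
sumTo-cong (suc n) e = cong₂ Q._+_ (sumTo-cong n (λ k k≤n → e k (NP.m≤n⇒m≤1+n k≤n))) (e (suc n) NP.≤-refl)

sumTo-+ : ∀ (h h' : ℕ → Q.ℚ) n → sumTo (λ k → h k Q.+ h' k) n ≡ sumTo h n Q.+ sumTo h' n
sumTo-+ h h' zero    = refl
sumTo-+ h h' (suc n) rewrite sumTo-+ h h' n = interchange (sumTo h n) (sumTo h' n) (h (suc n)) (h' (suc n))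
  where
  interchange : ∀ a b c d → (a Q.+ b) Q.+ (c Q.+ d) ≡ (a Q.+ c) Q.+ (b Q.+ d)
  interchange = solve-∀ ℚ-ring

sumTo-scale : ∀ c (h : ℕ → Q.ℚ) n → sumTo (λ k → c Q.* h k) n ≡ c Q.* sumTo h n
sumTo-scale c h zero    = refl
sumTo-scale c h (suc n) rewrite sumTo-scale c h n = sym (QP.*-distribˡ-+ c (sumTo h n) (h (suc n)))

sumTo-neg : ∀ (h : ℕ → Q.ℚ) n → sumTo (λ k → Q.- h k) n ≡ Q.- sumTo h n
sumTo-neg h zero    = refl
sumTo-neg h (suc n) rewrite sumTo-neg h n = sym (QP.neg-distrib-+ (sumTo h n) (h (suc n)))

sumTo-zero : ∀ (h : ℕ → Q.ℚ) n → (∀ k → h k ≡ Q.0ℚ) → sumTo h n ≡ Q.0ℚ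
sumTo-zero h zero    e = e 0
sumTo-zero h (suc n) e rewrite sumTo-zero h n e | e (suc n) = refl

sumTo-front : ∀ (h : ℕ → Q.ℚ) n → sumTo h (suc n) ≡ h 0 Q.+ sumTo (λ k → h (suc k)) n
sumTo-front h zero    = refl
sumTo-front h (suc n) rewrite sumTo-front h n = QP.+-assoc (h 0) (sumTo (λ k → h (suc k)) n) (h (suc (suc n)))

sumTo-reverse : ∀ (h : ℕ → Q.ℚ) n → sumTo h n ≡ sumTo (λ k → h (n ∸ k)) n
sumTo-reverse h zero    = refl
sumTo-reverse h (suc n) = begin
  sumTo h n Q.+ h (suc n)                           ≡⟨ cong (Q._+ h (suc n)) (sumTo-reverse h n) ⟩
  sumTo (λ k → h (n ∸ k)) n Q.+ h (suc n)           ≡⟨ QP.+-comm (sumTo (λ k → h (n ∸ k)) n) (h (suc n)) ⟩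
  h (suc n) Q.+ sumTo (λ k → h (n ∸ k)) n           ≡⟨ sym (sumTo-front (λ k → h (suc n ∸ k)) n) ⟩
  sumTo (λ k → h (suc n ∸ k)) (suc n)               ∎
  where open ≡-Reasoning

infix 4 _≗ₚ_
_≗ₚ_ : PS → PS → Set
f ≗ₚ g = ∀ n → f n ≡ g n

psSetoid : Setoid _ _
psSetoid = record
  { Carrier = PS ; _≈_ = _≗ₚ_
  ; isEquivalence = record { refl = λ _ → refl ; sym = λ e n → sym (e n) ; trans = λ e e' n → trans (e n) (e' n) } }

module PSReasoning = SetoidReasoning psSetoid

0ₚ : PS
0ₚ _ = Q.0ℚ

-ₚ_ : PS → PS
(-ₚ f) n = Q.- f n

tailₚ : PS → PS
tailₚ f n = f (suc n)

_·ₚ_ : Q.ℚ → PS → PS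
(c ·ₚ f) n = c Q.* f n

*ₚ-suc : ∀ f g n → (f *ₚ g) (suc n) ≡ f 0 Q.* g (suc n) Q.+ (tailₚ f *ₚ g) n
*ₚ-suc f g n = sumTo-front (λ k → f k Q.* g (suc n ∸ k)) n

+ₚ-cong : ∀ {f f' g g'} → f ≗ₚ f' → g ≗ₚ g' → (f +ₚ g) ≗ₚ (f' +ₚ g')
+ₚ-cong e e' n = cong₂ Q._+_ (e n) (e' n)

*ₚ-congˡ : ∀ {f f'} g → f ≗ₚ f' → (f *ₚ g) ≗ₚ (f' *ₚ g)
*ₚ-congˡ g e n = sumTo-cong n (λ k _ → cong (Q._* g (n ∸ k)) (e k))

*ₚ-comm : ∀ f g → (f *ₚ g) ≗ₚ (g *ₚ f)
*ₚ-comm f g n = trans (sumTo-reverse _ n) (sumTo-cong n (λ k k≤n →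
  trans (cong (λ t → f (n ∸ k) Q.* g t) (NP.m∸[m∸n]≡n k≤n)) (QP.*-comm (f (n ∸ k)) (g k))))

*ₚ-congʳ : ∀ f {g g'} → g ≗ₚ g' → (f *ₚ g) ≗ₚ (f *ₚ g')
*ₚ-congʳ f {g} {g'} e n = trans (*ₚ-comm f g n) (trans (*ₚ-congˡ f e n) (*ₚ-comm g' f n))

*ₚ-cong : ∀ {f f' g g'} → f ≗ₚ f' → g ≗ₚ g' → (f *ₚ g) ≗ₚ (f' *ₚ g')
*ₚ-cong {f} {f'} {g} e e' n = trans (*ₚ-congˡ g e n) (*ₚ-congʳ f' e' n)

*ₚ-distribʳ : ∀ f g h → ((f +ₚ g) *ₚ h) ≗ₚ ((f *ₚ h) +ₚ (g *ₚ h))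
*ₚ-distribʳ f g h n =
  trans (sumTo-cong n (λ k _ → QP.*-distribʳ-+ (h (n ∸ k)) (f k) (g k))) (sumTo-+ _ _ n)

*ₚ-distribˡ : ∀ f g h → (f *ₚ (g +ₚ h)) ≗ₚ ((f *ₚ g) +ₚ (f *ₚ h))
*ₚ-distribˡ f g h n = trans (*ₚ-comm f (g +ₚ h) n)
  (trans (*ₚ-distribʳ g h f n) (cong₂ Q._+_ (*ₚ-comm g f n) (*ₚ-comm h f n)))

*ₚ-scaleˡ : ∀ c f g → ((c ·ₚ f) *ₚ g) ≗ₚ (c ·ₚ (f *ₚ g))
*ₚ-scaleˡ c f g n = trans (sumTo-cong n (λ k _ → QP.*-assoc c (f k) (g (n ∸ k)))) (sumTo-scale c _ n)

*ₚ-negʳ : ∀ f g → (f *ₚ (-ₚ g)) ≗ₚ (-ₚ (f *ₚ g))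
*ₚ-negʳ f g n =
  trans (sumTo-cong n (λ k _ → sym (QP.neg-distribʳ-* (f k) (g (n ∸ k))))) (sumTo-neg _ n)

*ₚ-zeroˡ : ∀ f → (0ₚ *ₚ f) ≗ₚ 0ₚ
*ₚ-zeroˡ f n = sumTo-zero _ n (λ k → QP.*-zeroˡ (f (n ∸ k)))

*ₚ-identityˡ : ∀ f → (1ₚ *ₚ f) ≗ₚ f
*ₚ-identityˡ f zero    = QP.*-identityˡ (f 0)
*ₚ-identityˡ f (suc n) = trans (*ₚ-suc 1ₚ f n)
  (trans (cong₂ Q._+_ (QP.*-identityˡ (f (suc n))) (trans (*ₚ-congˡ {tailₚ 1ₚ} {0ₚ} f (λ _ → refl) n) (*ₚ-zeroˡ f n)))
         (QP.+-identityʳ (f (suc n))))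

*ₚ-assoc : ∀ f g h → ((f *ₚ g) *ₚ h) ≗ₚ (f *ₚ (g *ₚ h))
*ₚ-assoc f g h zero    = QP.*-assoc (f 0) (g 0) (h 0)
*ₚ-assoc f g h (suc n) = begin
  ((f *ₚ g) *ₚ h) (suc n)                                          ≡⟨ *ₚ-suc (f *ₚ g) h n ⟩
  (f 0 Q.* g 0) Q.* h (suc n) Q.+ (tailₚ (f *ₚ g) *ₚ h) n          ≡⟨ cong ((f 0 Q.* g 0) Q.* h (suc n) Q.+_) tail-expanded ⟩
  (f 0 Q.* g 0) Q.* h (suc n) Q.+ (f 0 Q.* (tailₚ g *ₚ h) n Q.+ (tailₚ f *ₚ (g *ₚ h)) n)
                                                                   ≡⟨ regroup (f 0) (g 0) (h (suc n)) ((tailₚ g *ₚ h) n) ((tailₚ f *ₚ (g *ₚ h)) n) ⟩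
  f 0 Q.* (g 0 Q.* h (suc n) Q.+ (tailₚ g *ₚ h) n) Q.+ (tailₚ f *ₚ (g *ₚ h)) n
                                                                   ≡⟨ cong (λ t → f 0 Q.* t Q.+ (tailₚ f *ₚ (g *ₚ h)) n) (sym (*ₚ-suc g h n)) ⟩
  f 0 Q.* (g *ₚ h) (suc n) Q.+ (tailₚ f *ₚ (g *ₚ h)) n             ≡⟨ sym (*ₚ-suc f (g *ₚ h) n) ⟩
  (f *ₚ (g *ₚ h)) (suc n)                                          ∎
  where
  open ≡-Reasoning
  tail-expanded : (tailₚ (f *ₚ g) *ₚ h) n ≡ f 0 Q.* (tailₚ g *ₚ h) n Q.+ (tailₚ f *ₚ (g *ₚ h)) n
  tail-expanded = trans (*ₚ-congˡ h (*ₚ-suc f g) n)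
    (trans (*ₚ-distribʳ (f 0 ·ₚ tailₚ g) (tailₚ f *ₚ g) h n)
           (cong₂ Q._+_ (*ₚ-scaleˡ (f 0) (tailₚ g) h n) (*ₚ-assoc (tailₚ f) g h n)))
  regroup : ∀ a b c d e → (a Q.* b) Q.* c Q.+ (a Q.* d Q.+ e) ≡ a Q.* (b Q.* c Q.+ d) Q.+ e
  regroup = solve-∀ ℚ-ring

qPowₚ : ℕ → PS
qPowₚ s = shiftₚ s 1ₚ

shift-cong : ∀ s {f g} → f ≗ₚ g → shiftₚ s f ≗ₚ shiftₚ s g
shift-cong s e N with N <ᵇ s
... | true  = refl
... | false = e (N ∸ s)

shift-≡ : ∀ {a b} f → a ≡ b → shiftₚ a f ≗ₚ shiftₚ b f
shift-≡ f refl N = refl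

shift-+ : ∀ s f g → shiftₚ s (f +ₚ g) ≗ₚ (shiftₚ s f +ₚ shiftₚ s g)
shift-+ s f g N with N <ᵇ s
... | true  = refl
... | false = refl

shift-neg : ∀ s f → shiftₚ s (-ₚ f) ≗ₚ (-ₚ shiftₚ s f)
shift-neg s f N with N <ᵇ s
... | true  = refl
... | false = refl

shift-0 : ∀ s → shiftₚ s 0ₚ ≗ₚ 0ₚ
shift-0 s N with N <ᵇ s
... | true  = refl
... | false = refl

shift-shift : ∀ s t g → shiftₚ s (shiftₚ t g) ≗ₚ shiftₚ (s + t) g
shift-shift zero    t g N       = refl
shift-shift (suc s) t g zero    = refl
shift-shift (suc s) t g (suc N) = shift-shift s t g N

shift-shift-≡ : ∀ a b c d f → a + b ≡ c + d → shiftₚ a (shiftₚ b f) ≗ₚ shiftₚ c (shiftₚ d f)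
shift-shift-≡ a b c d f e N =
  trans (shift-shift a b f N) (trans (shift-≡ f e N) (sym (shift-shift c d f N)))

shift-comm : ∀ s t g → shiftₚ s (shiftₚ t g) ≗ₚ shiftₚ t (shiftₚ s g)
shift-comm s t g = shift-shift-≡ s t t s g (NP.+-comm s t)

shift-cancel : ∀ s {f g} → shiftₚ s f ≗ₚ shiftₚ s g → f ≗ₚ g
shift-cancel s {f} {g} e N = trans (sym (shift-at s f N)) (trans (e (s + N)) (shift-at s g N))
  where
  shift-at : ∀ s f N → shiftₚ s f (s + N) ≡ f N
  shift-at zero    f N = refl
  shift-at (suc s) f N = shift-at s f N

qPowₚ-* : ∀ s f → (qPowₚ s *ₚ f) ≗ₚ shiftₚ s f
qPowₚ-* zero    f N       = trans (*ₚ-congˡ {qPowₚ 0} {1ₚ} f (λ _ → refl) N) (*ₚ-identityˡ f N)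
qPowₚ-* (suc s) f zero    = QP.*-zeroˡ (f 0)
qPowₚ-* (suc s) f (suc N) = trans (*ₚ-suc (qPowₚ (suc s)) f N)
  (trans (cong (Q._+ (qPowₚ s *ₚ f) N) (QP.*-zeroˡ (f (suc N))))
         (trans (QP.+-identityˡ _) (qPowₚ-* s f N)))

shift-*ˡ : ∀ s f g → (shiftₚ s f *ₚ g) ≗ₚ shiftₚ s (f *ₚ g)
shift-*ˡ s f g N = trans (*ₚ-congˡ g (λ n → sym (qPowₚ-* s f n)) N)
  (trans (*ₚ-assoc (qPowₚ s) f g N) (qPowₚ-* s (f *ₚ g) N))

shift-*ʳ : ∀ s f g → (f *ₚ shiftₚ s g) ≗ₚ shiftₚ s (f *ₚ g)
shift-*ʳ s f g N = trans (*ₚ-comm f (shiftₚ s g) N)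
  (trans (shift-*ˡ s g f N) (shift-cong s (*ₚ-comm g f) N))

shift-*-shift : ∀ a b f g → (shiftₚ a f *ₚ shiftₚ b g) ≗ₚ shiftₚ (a + b) (f *ₚ g)
shift-*-shift a b f g n = trans (shift-*ˡ a f (shiftₚ b g) n)
  (trans (shift-cong a (shift-*ʳ b f g) n) (shift-shift a b (f *ₚ g) n))

-- The geometric series: (1 − q^{i+1}) · Σ_k q^{k(i+1)} = 1.  Coefficientwise this is the
-- periodicity of geomInv i, which has period i+1.

geomInv-periodic : ∀ i M → i ≤ M → geomInv i (suc M) ≡ geomInv i (M ∸ i)
geomInv-periodic i M i≤M = cong (λ r → if r N.≡ᵇ 0 then Q.1ℚ else Q.0ℚ) period
  where
  period : suc M % suc i ≡ (M ∸ i) % suc i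
  period = trans (cong (_% suc i) (sym (trans (NP.+-suc (M ∸ i) i) (cong suc (NP.m∸n+n≡m i≤M)))))
                 ([m+n]%n≡m%n (M ∸ i) (suc i))

geomInv-telescopes : ∀ i N → geomInv i N Q.+ Q.- shiftₚ (suc i) (geomInv i) N ≡ 1ₚ N
geomInv-telescopes i zero = refl
geomInv-telescopes i (suc M) with M <ᵇ i in eq
... | true  = cong (λ r → (if r N.≡ᵇ 0 then Q.1ℚ else Q.0ℚ) Q.+ Q.- Q.0ℚ)
                   (m<n⇒m%n≡m (N.s≤s (NP.<ᵇ⇒< M i (subst T (sym eq) tt))))
... | false = trans (cong (λ t → t Q.+ Q.- geomInv i (M ∸ i)) (geomInv-periodic i M i≤M))
                    (QP.+-inverseʳ (geomInv i (M ∸ i)))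
  where
  i≤M : i ≤ M
  i≤M = NP.≮⇒≥ (λ lt → subst T eq (NP.<⇒<ᵇ lt))

geomInv-inverse : ∀ i → (geomInv i *ₚ (1ₚ +ₚ (-ₚ qPowₚ (suc i)))) ≗ₚ 1ₚ
geomInv-inverse i N = trans (*ₚ-distribˡ (geomInv i) 1ₚ (-ₚ qPowₚ (suc i)) N)
  (trans (cong₂ Q._+_ (trans (*ₚ-comm (geomInv i) 1ₚ N) (*ₚ-identityˡ (geomInv i) N))
                      (trans (*ₚ-negʳ (geomInv i) (qPowₚ (suc i)) N)
                             (cong Q.-_ (trans (*ₚ-comm (geomInv i) (qPowₚ (suc i)) N) (qPowₚ-* (suc i) (geomInv i) N)))))
         (geomInv-telescopes i N))

0L : Laurent
0L = fromPS 0ₚ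

≈L-refl : ∀ {x} → x ≈L x
≈L-refl N = refl

≈L-sym : ∀ {x y} → x ≈L y → y ≈L x
≈L-sym e N = sym (e N)

≈L-trans : ∀ {x y z} → x ≈L y → y ≈L z → x ≈L z
≈L-trans {laurent a f} {laurent b g} {laurent c h} p q = shift-cancel b (begin
  shiftₚ b (shiftₚ c f) ≈⟨ shift-comm b c f ⟩
  shiftₚ c (shiftₚ b f) ≈⟨ shift-cong c p ⟩
  shiftₚ c (shiftₚ a g) ≈⟨ shift-comm c a g ⟩
  shiftₚ a (shiftₚ c g) ≈⟨ shift-cong a q ⟩
  shiftₚ a (shiftₚ b h) ≈⟨ shift-comm a b h ⟩
  shiftₚ b (shiftₚ a h) ∎)
  where open PSReasoning

≈L-≡ : ∀ d e f g → d ≡ e → f ≗ₚ g → laurent d f ≈L laurent e g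
≈L-≡ d .d f g refl e = shift-cong d e

+L-cong : ∀ {x x' y y'} → x ≈L x' → y ≈L y' → (x +L y) ≈L (x' +L y')
+L-cong {laurent d f} {laurent d' f'} {laurent e g} {laurent e' g'} p q = begin
  shiftₚ (d' + e') (shiftₚ e f +ₚ shiftₚ d g)
    ≈⟨ shift-+ (d' + e') (shiftₚ e f) (shiftₚ d g) ⟩
  shiftₚ (d' + e') (shiftₚ e f) +ₚ shiftₚ (d' + e') (shiftₚ d g)
    ≈⟨ +ₚ-cong (shift-shift-≡ (d' + e') e (e' + e) d' f (sum₁ d' e' e)) (shift-shift-≡ (d' + e') d (d' + d) e' g (sum₂ d' e' d)) ⟩
  shiftₚ (e' + e) (shiftₚ d' f) +ₚ shiftₚ (d' + d) (shiftₚ e' g)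
    ≈⟨ +ₚ-cong (shift-cong (e' + e) p) (shift-cong (d' + d) q) ⟩
  shiftₚ (e' + e) (shiftₚ d f') +ₚ shiftₚ (d' + d) (shiftₚ e g')
    ≈⟨ +ₚ-cong (shift-shift-≡ (e' + e) d (d + e) e' f' (sum₃ e' e d)) (shift-shift-≡ (d' + d) e (d + e) d' g' (sum₄ d' d e)) ⟩
  shiftₚ (d + e) (shiftₚ e' f') +ₚ shiftₚ (d + e) (shiftₚ d' g')
    ≈⟨ (λ n → sym (shift-+ (d + e) (shiftₚ e' f') (shiftₚ d' g') n)) ⟩
  shiftₚ (d + e) (shiftₚ e' f' +ₚ shiftₚ d' g') ∎
  where
  open PSReasoning
  sum₁ : ∀ d' e' e → (d' + e') + e ≡ (e' + e) + d'
  sum₁ = ℕ-solve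
  sum₂ : ∀ d' e' d → (d' + e') + d ≡ (d' + d) + e'
  sum₂ = ℕ-solve
  sum₃ : ∀ e' e d → (e' + e) + d ≡ (d + e) + e'
  sum₃ = ℕ-solve
  sum₄ : ∀ d' d e → (d' + d) + e ≡ (d + e) + d'
  sum₄ = ℕ-solve

*L-cong : ∀ {x x' y y'} → x ≈L x' → y ≈L y' → (x *L y) ≈L (x' *L y')
*L-cong {laurent d f} {laurent d' f'} {laurent e g} {laurent e' g'} p q = begin
  shiftₚ (d' + e') (f *ₚ g)   ≈⟨ (λ n → sym (shift-*-shift d' e' f g n)) ⟩
  shiftₚ d' f *ₚ shiftₚ e' g  ≈⟨ *ₚ-cong p q ⟩
  shiftₚ d f' *ₚ shiftₚ e g'  ≈⟨ shift-*-shift d e f' g' ⟩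
  shiftₚ (d + e) (f' *ₚ g')   ∎
  where open PSReasoning

-L-cong : ∀ {x x'} → x ≈L x' → (-L x) ≈L (-L x')
-L-cong {laurent d f} {laurent d' f'} p n =
  trans (shift-neg d' f n) (trans (cong Q.-_ (p n)) (sym (shift-neg d f' n)))

+L-assoc : ∀ x y z → ((x +L y) +L z) ≈L (x +L (y +L z))
+L-assoc (laurent d f) (laurent e g) (laurent h k) = ≈L-≡ _ _ _ _ (NP.+-assoc d e h) (begin
  shiftₚ h (shiftₚ e f +ₚ shiftₚ d g) +ₚ shiftₚ (d + e) k
    ≈⟨ +ₚ-cong (shift-+ h (shiftₚ e f) (shiftₚ d g)) (λ _ → refl) ⟩
  (shiftₚ h (shiftₚ e f) +ₚ shiftₚ h (shiftₚ d g)) +ₚ shiftₚ (d + e) k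
    ≈⟨ (λ n → QP.+-assoc (shiftₚ h (shiftₚ e f) n) (shiftₚ h (shiftₚ d g) n) (shiftₚ (d + e) k n)) ⟩
  shiftₚ h (shiftₚ e f) +ₚ (shiftₚ h (shiftₚ d g) +ₚ shiftₚ (d + e) k)
    ≈⟨ +ₚ-cong (λ n → trans (shift-shift h e f n) (shift-≡ f (NP.+-comm h e) n))
               (+ₚ-cong (shift-comm h d g) (λ n → sym (shift-shift d e k n))) ⟩
  shiftₚ (e + h) f +ₚ (shiftₚ d (shiftₚ h g) +ₚ shiftₚ d (shiftₚ e k))
    ≈⟨ +ₚ-cong {shiftₚ (e + h) f} (λ _ → refl) (λ n → sym (shift-+ d (shiftₚ h g) (shiftₚ e k) n)) ⟩
  shiftₚ (e + h) f +ₚ shiftₚ d (shiftₚ h g +ₚ shiftₚ e k) ∎)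
  where open PSReasoning

+L-comm : ∀ x y → (x +L y) ≈L (y +L x)
+L-comm (laurent d f) (laurent e g) =
  ≈L-≡ _ _ _ _ (NP.+-comm d e) (λ n → QP.+-comm (shiftₚ e f n) (shiftₚ d g n))

+L-identityˡ : ∀ x → (0L +L x) ≈L x
+L-identityˡ (laurent d f) =
  ≈L-≡ d d _ f refl (λ n → trans (cong (Q._+ f n) (shift-0 d n)) (QP.+-identityˡ (f n)))

+L-inverseˡ : ∀ x → ((-L x) +L x) ≈L 0L
+L-inverseˡ (laurent d f) n = trans (cong (Q._+ shiftₚ d f n) (shift-neg d f n))
  (trans (QP.+-inverseˡ (shiftₚ d f n)) (sym (shift-0 (d + d) n)))

*L-assoc : ∀ x y z → ((x *L y) *L z) ≈L (x *L (y *L z))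
*L-assoc (laurent d f) (laurent e g) (laurent h k) = ≈L-≡ _ _ _ _ (NP.+-assoc d e h) (*ₚ-assoc f g k)

*L-comm : ∀ x y → (x *L y) ≈L (y *L x)
*L-comm (laurent d f) (laurent e g) = ≈L-≡ _ _ _ _ (NP.+-comm d e) (*ₚ-comm f g)

*L-identityˡ : ∀ x → (1L *L x) ≈L x
*L-identityˡ (laurent d f) = ≈L-≡ d d _ f refl (*ₚ-identityˡ f)

*L-distribˡ : ∀ x y z → (x *L (y +L z)) ≈L ((x *L y) +L (x *L z))
*L-distribˡ (laurent d f) (laurent e g) (laurent h k) = begin
  shiftₚ D (f *ₚ (shiftₚ h g +ₚ shiftₚ e k))
    ≈⟨ shift-cong D (*ₚ-distribˡ f (shiftₚ h g) (shiftₚ e k)) ⟩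
  shiftₚ D ((f *ₚ shiftₚ h g) +ₚ (f *ₚ shiftₚ e k))
    ≈⟨ shift-cong D (+ₚ-cong (shift-*ʳ h f g) (shift-*ʳ e f k)) ⟩
  shiftₚ D (shiftₚ h (f *ₚ g) +ₚ shiftₚ e (f *ₚ k))
    ≈⟨ shift-+ D (shiftₚ h (f *ₚ g)) (shiftₚ e (f *ₚ k)) ⟩
  shiftₚ D (shiftₚ h (f *ₚ g)) +ₚ shiftₚ D (shiftₚ e (f *ₚ k))
    ≈⟨ +ₚ-cong (shift-shift-≡ D h D' (d + h) (f *ₚ g) (sum₁ d e h)) (shift-shift-≡ D e D' (d + e) (f *ₚ k) (sum₂ d e h)) ⟩
  shiftₚ D' (shiftₚ (d + h) (f *ₚ g)) +ₚ shiftₚ D' (shiftₚ (d + e) (f *ₚ k))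
    ≈⟨ (λ n → sym (shift-+ D' (shiftₚ (d + h) (f *ₚ g)) (shiftₚ (d + e) (f *ₚ k)) n)) ⟩
  shiftₚ D' (shiftₚ (d + h) (f *ₚ g) +ₚ shiftₚ (d + e) (f *ₚ k)) ∎
  where
  open PSReasoning
  D D' : ℕ
  D  = (d + e) + (d + h)
  D' = d + (e + h)
  sum₁ : ∀ d e h → ((d + e) + (d + h)) + h ≡ (d + (e + h)) + (d + h)
  sum₁ = ℕ-solve
  sum₂ : ∀ d e h → ((d + e) + (d + h)) + e ≡ (d + (e + h)) + (d + e)
  sum₂ = ℕ-solve

-- ≈L unfolds to a Π-type from which its two sides cannot be recovered by unification;
-- wrapping it in a record lets the ring lemmas and the solver infer their implicit arguments.
infix 4 _≈R_
record _≈R_ (x y : Laurent) : Set where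
  constructor mkR
  field getR : x ≈L y
open _≈R_ public

laurentRing : CommutativeRing _ _
laurentRing = record
  { Carrier = Laurent ; _≈_ = _≈R_ ; _+_ = _+L_ ; _*_ = _*L_ ; -_ = -L_ ; 0# = 0L ; 1# = 1L
  ; isCommutativeRing = record
    { isRing = record
      { +-isAbelianGroup = record
        { isGroup = record
          { isMonoid = record
            { isSemigroup = record
              { isMagma = record
                { isEquivalence = record
                  { refl  = λ {x} → mkR (≈L-refl {x})
                  ; sym   = λ {x} {y} p → mkR (≈L-sym {x} {y} (getR p))
                  ; trans = λ {x} {y} {z} p q → mkR (≈L-trans {x} {y} {z} (getR p) (getR q)) }
                ; ∙-cong = λ {x} {x'} {y} {y'} p q → mkR (+L-cong {x} {x'} {y} {y'} (getR p) (getR q)) }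
              ; assoc = λ x y z → mkR (+L-assoc x y z) }
            ; identity = (λ x → mkR (+L-identityˡ x))
                       , (λ x → mkR (≈L-trans {x +L 0L} {0L +L x} {x} (+L-comm x 0L) (+L-identityˡ x))) }
          ; inverse = (λ x → mkR (+L-inverseˡ x))
                    , (λ x → mkR (≈L-trans {x +L (-L x)} {(-L x) +L x} {0L} (+L-comm x (-L x)) (+L-inverseˡ x)))
          ; ⁻¹-cong = λ {x} {x'} p → mkR (-L-cong {x} {x'} (getR p)) }
        ; comm = λ x y → mkR (+L-comm x y) }
      ; *-cong = λ {x} {x'} {y} {y'} p q → mkR (*L-cong {x} {x'} {y} {y'} (getR p) (getR q))
      ; *-assoc = λ x y z → mkR (*L-assoc x y z)
      ; *-identity = (λ x → mkR (*L-identityˡ x))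
                   , (λ x → mkR (≈L-trans {x *L 1L} {1L *L x} {x} (*L-comm x 1L) (*L-identityˡ x)))
      ; distrib = (λ x y z → mkR (*L-distribˡ x y z))
                , (λ x y z → mkR (distribʳ x y z)) }
    ; *-comm = λ x y → mkR (*L-comm x y) } }
  where
  distribʳ : ∀ x y z → ((y +L z) *L x) ≈L ((y *L x) +L (z *L x))
  distribʳ x y z =
    ≈L-trans {(y +L z) *L x} {x *L (y +L z)} {(y *L x) +L (z *L x)} (*L-comm (y +L z) x)
      (≈L-trans {x *L (y +L z)} {(x *L y) +L (x *L z)} {(y *L x) +L (z *L x)} (*L-distribˡ x y z)
        (+L-cong {x *L y} {y *L x} {x *L z} {z *L x} (*L-comm x y) (*L-comm x z)))

-- It sends 1 and 0
-- to 1L and 0L on the nose, so that solver goals mentioning 1L and 0L unify with the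
-- literal Laurent series of Defs.

constₚ : Q.ℚ → PS
constₚ c zero    = c
constₚ c (suc _) = Q.0ℚ

constSeries : Q.ℚ → PS
constSeries c with c QP.≟ Q.1ℚ
... | yes _ = 1ₚ
... | no _ with c QP.≟ Q.0ℚ
...   | yes _ = 0ₚ
...   | no _  = constₚ c

constSeries≗constₚ : ∀ c → constSeries c ≗ₚ constₚ c
constSeries≗constₚ c with c QP.≟ Q.1ℚ
... | yes p = λ { zero → sym p ; (suc n) → refl }
... | no _ with c QP.≟ Q.0ℚ
...   | yes p = λ { zero → sym p ; (suc n) → refl }
...   | no _  = λ _ → refl

⟦_⟧ᶜ : Q.ℚ → Laurent
⟦ c ⟧ᶜ = fromPS (constSeries c)

constₚ-+ : ∀ a b → (constₚ a +ₚ constₚ b) ≗ₚ constₚ (a Q.+ b)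
constₚ-+ a b zero    = refl
constₚ-+ a b (suc n) = QP.+-identityˡ Q.0ℚ

constₚ-* : ∀ a b → (constₚ a *ₚ constₚ b) ≗ₚ constₚ (a Q.* b)
constₚ-* a b zero    = refl
constₚ-* a b (suc n) = trans (*ₚ-suc (constₚ a) (constₚ b) n)
  (trans (cong₂ Q._+_ (QP.*-zeroʳ a) (trans (*ₚ-congˡ {tailₚ (constₚ a)} {0ₚ} (constₚ b) (λ _ → refl) n) (*ₚ-zeroˡ (constₚ b) n)))
         (QP.+-identityˡ Q.0ℚ))

⟦⟧ᶜ-≈ : ∀ {a} (g : PS) → constₚ a ≗ₚ g → ⟦ a ⟧ᶜ ≈R fromPS g
⟦⟧ᶜ-≈ {a} g e = mkR (≈L-≡ 0 0 _ _ refl (λ n → trans (constSeries≗constₚ a n) (e n)))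

ℚ-rawRing : RawRing _ _
ℚ-rawRing = CommutativeRing.rawRing QP.+-*-commutativeRing

laurentACR : ACR.AlmostCommutativeRing _ _
laurentACR = ACR.fromCommutativeRing laurentRing

constMorphism : ℚ-rawRing ACR.-Raw-AlmostCommutative⟶ laurentACR
constMorphism = record
  { ⟦_⟧    = ⟦_⟧ᶜ
  ; +-homo = λ a b → ⟦⟧ᶜ-≈ _ (λ n → sym (trans (+ₚ-cong (constSeries≗constₚ a) (constSeries≗constₚ b) n) (constₚ-+ a b n)))
  ; *-homo = λ a b → ⟦⟧ᶜ-≈ _ (λ n → sym (trans (*ₚ-cong (constSeries≗constₚ a) (constSeries≗constₚ b) n) (constₚ-* a b n)))
  ; -‿homo = λ a → ⟦⟧ᶜ-≈ _ (λ { zero → sym (cong Q.-_ (constSeries≗constₚ a 0)) ; (suc n) → sym (cong Q.-_ (constSeries≗constₚ a (suc n))) })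
  ; 0-homo = ⟦⟧ᶜ-≈ _ (λ { zero → refl ; (suc n) → refl })
  ; 1-homo = mkR (λ _ → refl)
  }

constEquality? : ∀ a b → Maybe (⟦ a ⟧ᶜ ≈R ⟦ b ⟧ᶜ)
constEquality? a b with a QP.≟ b
... | yes refl = just (mkR (λ _ → refl))
... | no _     = nothing

open import Algebra.Solver.Ring ℚ-rawRing laurentACR constMorphism constEquality?
open CommutativeRing laurentRing using (+-cong; *-cong; -‿cong; *-comm; *-assoc; *-identityˡ; *-identityʳ)
  renaming (refl to ≈refl; sym to ≈sym; trans to ≈trans; setoid to laurentSetoid)
open SetoidReasoning laurentSetoid

one : ∀ {n} → Polynomial n
one = con Q.1ℚ

-- Reflexivity with the element given explicitly, to guide inference inside congruences.
rf : ∀ x → x ≈R x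
rf x = ≈refl {x}

≡⇒≈R : ∀ {x y} → x ≡ y → x ≈R y
≡⇒≈R {x} refl = rf x

sumL-cong : ∀ {f g} → (∀ i → f i ≈R g i) → ∀ n → sumL f n ≈R sumL g n
sumL-cong e zero    = e 0
sumL-cong e (suc n) = +-cong (sumL-cong e n) (e (suc n))

sumL-+ : ∀ f g n → sumL (λ i → f i +L g i) n ≈R sumL f n +L sumL g n
sumL-+ f g zero    = rf (f 0 +L g 0)
sumL-+ f g (suc n) = ≈trans (+-cong (sumL-+ f g n) (rf (f (suc n) +L g (suc n))))
                            (interchange (sumL f n) (sumL g n) (f (suc n)) (g (suc n)))
  where
  interchange : ∀ a b c d → (a +L b) +L (c +L d) ≈R (a +L c) +L (b +L d)
  interchange = solve 4 (λ a b c d → (a :+ b) :+ (c :+ d) := (a :+ c) :+ (b :+ d)) ≈refl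

sumL-scale : ∀ a f n → sumL (λ i → a *L f i) n ≈R a *L sumL f n
sumL-scale a f zero    = rf (a *L f 0)
sumL-scale a f (suc n) = ≈trans (+-cong (sumL-scale a f n) (rf (a *L f (suc n)))) (distrib a (sumL f n) (f (suc n)))
  where
  distrib : ∀ a b c → (a *L b) +L (a *L c) ≈R a *L (b +L c)
  distrib = solve 3 (λ a b c → (a :* b) :+ (a :* c) := a :* (b :+ c)) ≈refl

sumL-neg : ∀ f n → sumL (λ i → -L f i) n ≈R -L sumL f n
sumL-neg f zero    = rf (-L f 0)
sumL-neg f (suc n) = ≈trans (+-cong (sumL-neg f n) (rf (-L f (suc n)))) (distrib (sumL f n) (f (suc n)))
  where
  distrib : ∀ a b → (-L a) +L (-L b) ≈R -L (a +L b)
  distrib = solve 2 (λ a b → (:- a) :+ (:- b) := :- (a :+ b)) ≈refl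

sumL-front : ∀ f n → sumL f (suc n) ≈R f 0 +L sumL (λ i → f (suc i)) n
sumL-front f zero    = rf (f 0 +L f 1)
sumL-front f (suc n) = ≈trans (+-cong (sumL-front f n) (rf (f (suc (suc n)))))
                              (assoc (f 0) (sumL (λ i → f (suc i)) n) (f (suc (suc n))))
  where
  assoc : ∀ a b c → (a +L b) +L c ≈R a +L (b +L c)
  assoc = solve 3 (λ a b c → (a :+ b) :+ c := a :+ (b :+ c)) ≈refl

qp : ℕ → Laurent
qp n = qpow (+ n)

q : Laurent
q = qp 1

invPoch : ℕ → Laurent
invPoch n = fromPS (invqPoch n)

qp-+ : ∀ a b → qp (a + b) ≈R qp a *L qp b
qp-+ a b = mkR (≈L-≡ 0 0 _ _ refl (λ N → sym (trans (qPowₚ-* a (qPowₚ b) N) (shift-shift a b 1ₚ N))))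

qp-suc : ∀ i → qp (suc i) ≈R q *L qp i
qp-suc i = qp-+ 1 i

qp-zero : qp 0 ≈R 1L
qp-zero = mkR (≈L-≡ 0 0 _ _ refl (λ N → refl))

qp-inverse : ∀ a → qp a *L qpow (- (+ a)) ≈R 1L
qp-inverse zero    = mkR (≈L-≡ 0 0 _ _ refl (λ N → qPowₚ-* 0 (qPowₚ 0) N))
qp-inverse (suc k) = mkR (λ N → qPowₚ-* (suc k) 1ₚ N)

invPoch-step : ∀ k → invPoch (suc k) *L (1L -L q *L qp k) ≈R invPoch k
invPoch-step k = ≈trans (*-cong (rf (invPoch (suc k))) (+-cong (rf 1L) (-‿cong (≈sym (qp-suc k)))))
  (mkR (≈L-≡ 0 0 _ _ refl (λ N →
    trans (*ₚ-assoc (invqPoch k) (geomInv k) (1ₚ +ₚ (-ₚ qPowₚ (suc k))) N)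
      (trans (*ₚ-congʳ (invqPoch k) (geomInv-inverse k) N)
        (trans (*ₚ-comm (invqPoch k) 1ₚ N) (*ₚ-identityˡ (invqPoch k) N))))))

poch-cong : ∀ {x x'} → x ≈R x' → ∀ i → poch x i ≈R poch x' i
poch-cong e zero    = rf 1L
poch-cong e (suc i) = *-cong (poch-cong e i) (+-cong (rf 1L) (-‿cong (*-cong e (rf (qpow (+ i))))))

poch-shift : ∀ y i → poch y (suc i) ≈R (1L -L y) *L poch (y *L q) i
poch-shift y zero = begin
  1L *L (1L -L y *L qp 0) ≈⟨ *-cong (rf 1L) (+-cong (rf 1L) (-‿cong (*-cong (rf y) qp-zero))) ⟩
  1L *L (1L -L y *L 1L)   ≈⟨ simplify y ⟩
  (1L -L y) *L 1L         ∎
  where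
  simplify : ∀ y → 1L *L (1L -L y *L 1L) ≈R (1L -L y) *L 1L
  simplify = solve 1 (λ y → one :* (one :- y :* one) := (one :- y) :* one) ≈refl
poch-shift y (suc i) = begin
  poch y (suc i) *L (1L -L y *L qp (suc i))
    ≈⟨ *-cong (poch-shift y i) (+-cong (rf 1L) (-‿cong (*-cong (rf y) (qp-suc i)))) ⟩
  ((1L -L y) *L poch (y *L q) i) *L (1L -L y *L (q *L qp i))
    ≈⟨ regroup y q (qp i) (poch (y *L q) i) ⟩
  (1L -L y) *L (poch (y *L q) i *L (1L -L (y *L q) *L qp i)) ∎
  where
  regroup : ∀ y q qi P → ((1L -L y) *L P) *L (1L -L y *L (q *L qi)) ≈R (1L -L y) *L (P *L (1L -L (y *L q) *L qi))
  regroup = solve 4 (λ y q qi P → ((one :- y) :* P) :* (one :- y :* (q :* qi)) := (one :- y) :* (P :* (one :- (y :* q) :* qi))) ≈refl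

poch-vanishes : ∀ x l → x *L qp l ≈R 1L → poch x (suc l) ≈R 0L
poch-vanishes x l e = begin
  poch x l *L (1L -L x *L qp l) ≈⟨ *-cong (rf (poch x l)) (+-cong (rf 1L) (-‿cong e)) ⟩
  poch x l *L (1L -L 1L)        ≈⟨ annihilate (poch x l) ⟩
  0L                            ∎
  where
  annihilate : ∀ P → P *L (1L -L 1L) ≈R 0L
  annihilate = solve 1 (λ P → P :* (one :- one) := con Q.0ℚ) ≈refl

Bnum-cong : ∀ {z z'} → z ≈R z' → ∀ n → Bnum n z ≈R Bnum n z'
Bnum-cong e zero    = rf 1L
Bnum-cong e (suc n) = *-cong (Bnum-cong e n) (+-cong e (rf (-L qp n)))

B-cong : ∀ {z z'} → z ≈R z' → ∀ n → B n z ≈R B n z'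
B-cong e n = *-cong (Bnum-cong e n) (rf (invPoch n))

Bnum-at-qz : ∀ k z → Bnum (suc k) (q *L z) ≈R ((q *L z) -L 1L) *L (qp k *L Bnum k z)
Bnum-at-qz zero z = begin
  1L *L ((q *L z) -L qp 0)          ≈⟨ *-cong (rf 1L) (+-cong (rf (q *L z)) (-‿cong qp-zero)) ⟩
  1L *L ((q *L z) -L 1L)            ≈⟨ simplify (q *L z) ⟩
  ((q *L z) -L 1L) *L (1L *L 1L)    ≈⟨ *-cong (rf ((q *L z) -L 1L)) (*-cong (≈sym qp-zero) (rf 1L)) ⟩
  ((q *L z) -L 1L) *L (qp 0 *L 1L)  ∎
  where
  simplify : ∀ w → 1L *L (w -L 1L) ≈R (w -L 1L) *L (1L *L 1L)
  simplify = solve 1 (λ w → one :* (w :- one) := (w :- one) :* (one :* one)) ≈refl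
Bnum-at-qz (suc k) z = begin
  Bnum (suc k) (q *L z) *L ((q *L z) -L qp (suc k))
    ≈⟨ *-cong (Bnum-at-qz k z) (+-cong (rf (q *L z)) (-‿cong (qp-suc k))) ⟩
  (((q *L z) -L 1L) *L (qp k *L Bnum k z)) *L ((q *L z) -L q *L qp k)
    ≈⟨ regroup q z (qp k) (Bnum k z) ⟩
  ((q *L z) -L 1L) *L ((q *L qp k) *L (Bnum k z *L (z -L qp k)))
    ≈⟨ *-cong (rf ((q *L z) -L 1L)) (*-cong (≈sym (qp-suc k)) (rf (Bnum (suc k) z))) ⟩
  ((q *L z) -L 1L) *L (qp (suc k) *L Bnum (suc k) z) ∎
  where
  regroup : ∀ q z qk Bk → (((q *L z) -L 1L) *L (qk *L Bk)) *L ((q *L z) -L q *L qk)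
                          ≈R ((q *L z) -L 1L) *L ((q *L qk) *L (Bk *L (z -L qk)))
  regroup = solve 4 (λ q z qk Bk → (((q :* z) :- one) :* (qk :* Bk)) :* ((q :* z) :- q :* qk)
                          := ((q :* z) :- one) :* ((q :* qk) :* (Bk :* (z :- qk)))) ≈refl

B-at-qz : ∀ k z → B (suc k) (q *L z) ≈R B (suc k) z -L z *L B k z
B-at-qz k z = begin
  Bnum (suc k) (q *L z) *L invPoch (suc k)
    ≈⟨ *-cong (Bnum-at-qz k z) (rf (invPoch (suc k))) ⟩
  (((q *L z) -L 1L) *L (qp k *L Bnum k z)) *L I'
    ≈⟨ expand q z (qp k) (Bnum k z) I' ⟩
  (Bnum k z *L (z -L qp k)) *L I' -L z *L (Bnum k z *L (I' *L (1L -L q *L qp k)))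
    ≈⟨ +-cong (rf ((Bnum k z *L (z -L qp k)) *L I')) (-‿cong (*-cong (rf z) (*-cong (rf (Bnum k z)) (invPoch-step k)))) ⟩
  (Bnum k z *L (z -L qp k)) *L I' -L z *L (Bnum k z *L invPoch k) ∎
  where
  I' : Laurent
  I' = invPoch (suc k)
  expand : ∀ q z qk Bk I' → (((q *L z) -L 1L) *L (qk *L Bk)) *L I'
                            ≈R (Bk *L (z -L qk)) *L I' -L z *L (Bk *L (I' *L (1L -L q *L qk)))
  expand = solve 5 (λ q z qk Bk I' → (((q :* z) :- one) :* (qk :* Bk)) :* I'
                            := (Bk :* (z :- qk)) :* I' :- z :* (Bk :* (I' :* (one :- q :* qk)))) ≈refl

B-vanishes : ∀ m → B (suc m) (qp m) ≈R 0L
B-vanishes m = annihilate (Bnum m (qp m)) (qp m) (invPoch (suc m))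
  where
  annihilate : ∀ P w I' → (P *L (w -L w)) *L I' ≈R 0L
  annihilate = solve 3 (λ P w I' → (P :* (w :- w)) :* I' := con Q.0ℚ) ≈refl

-- Bsum c m l = Σ_{n=0}^{m} c(l+n) B_n(q^m) satisfies
--   Bsum c (m+1) l = Bsum c m l − q^m Bsum c m (l+1):
-- expand B_{n+1}(q^{m+1}) by B-at-qz; the term n = m+1 of the first sum vanishes by B-vanishes.

Bsum : (ℕ → Laurent) → ℕ → ℕ → Laurent
Bsum c m l = sumL (λ n → c (l + n) *L B n (qp m)) m

Bsum-step : ∀ c m l → Bsum c (suc m) l ≈R Bsum c m l -L qp m *L Bsum c m (suc l)
Bsum-step c m l = begin
  sumL F (suc m)
    ≈⟨ sumL-front F m ⟩
  F 0 +L sumL (λ n → F (suc n)) m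
    ≈⟨ +-cong (rf (F 0)) (≈trans (sumL-cong term-split m) (sumL-+ G H m)) ⟩
  F 0 +L (sumL G m +L sumL H m)
    ≈⟨ +-cong (rf (F 0)) (+-cong (rf (sumL G m)) (≈trans (sumL-neg (λ n → qp m *L K n) m) (-‿cong (sumL-scale (qp m) K m)))) ⟩
  F 0 +L (sumL G m +L (-L (qp m *L sumL K m)))
    ≈⟨ regroup (F 0) (sumL G m) (qp m *L sumL K m) ⟩
  (F 0 +L sumL G m) -L qp m *L sumL K m
    ≈⟨ +-cong (≈trans (≈sym (sumL-front F' m)) last-term-vanishes) (rf (-L (qp m *L sumL K m))) ⟩
  Bsum c m l -L qp m *L Bsum c m (suc l) ∎
  where
  F F' G H K : ℕ → Laurent
  F n  = c (l + n) *L B n (qp (suc m))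
  F' n = c (l + n) *L B n (qp m)
  G n  = F' (suc n)
  K n  = c (suc l + n) *L B n (qp m)
  H n  = -L (qp m *L K n)
  regroup : ∀ a b c → a +L (b +L (-L c)) ≈R (a +L b) -L c
  regroup = solve 3 (λ a b c → a :+ (b :+ (:- c)) := (a :+ b) :- c) ≈refl
  distribute : ∀ a X w Y → a *L (X -L w *L Y) ≈R a *L X +L (-L (w *L (a *L Y)))
  distribute = solve 4 (λ a X w Y → a :* (X :- w :* Y) := a :* X :+ (:- (w :* (a :* Y)))) ≈refl
  term-split : ∀ n → F (suc n) ≈R G n +L H n
  term-split n = begin
    c (l + suc n) *L B (suc n) (qp (suc m))
      ≈⟨ *-cong (rf (c (l + suc n))) (≈trans (B-cong (qp-suc m) (suc n)) (B-at-qz n (qp m))) ⟩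
    c (l + suc n) *L (B (suc n) (qp m) -L qp m *L B n (qp m))
      ≈⟨ distribute (c (l + suc n)) (B (suc n) (qp m)) (qp m) (B n (qp m)) ⟩
    G n +L (-L (qp m *L (c (l + suc n) *L B n (qp m))))
      ≈⟨ +-cong (rf (G n)) (-‿cong (*-cong (rf (qp m)) (*-cong (≡⇒≈R (cong c (NP.+-suc l n))) (rf (B n (qp m)))))) ⟩
    G n +L H n ∎
  drop-zero : ∀ s x → s +L x *L 0L ≈R s
  drop-zero = solve 2 (λ s x → s :+ x :* con Q.0ℚ := s) ≈refl
  last-term-vanishes : sumL F' (suc m) ≈R Bsum c m l
  last-term-vanishes = ≈trans (+-cong (rf (Bsum c m l)) (*-cong (rf (c (l + suc m))) (B-vanishes m)))
                              (drop-zero (Bsum c m l) (c (l + suc m)))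

nablaTerm : (ℕ → PS) → ℕ → ℕ → Laurent
nablaTerm b n i = qpow (+ i) *L poch (qpow (- (+ n))) i *L fromPS (invqPoch i) *L fromPS (b i)

nabla-cong : ∀ b b' → (∀ j → b j ≡ b' j) → ∀ l → nabla b l ≈R nabla b' l
nabla-cong b b' e l = sumL-cong (λ i → ≡⇒≈R (cong (λ t → weight i *L fromPS t) (e i))) l
  where
  weight : ℕ → Laurent
  weight i = qpow (+ i) *L poch (qpow (- (+ l))) i *L fromPS (invqPoch i)

qpow-neg-suc : ∀ l → qpow (- (+ suc l)) *L q ≈R qpow (- (+ l))
qpow-neg-suc l = begin
  y *L q                  ≈⟨ ≈sym (*-identityʳ (y *L q)) ⟩
  (y *L q) *L 1L          ≈⟨ *-cong (rf (y *L q)) (≈sym (qp-inverse l)) ⟩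
  (y *L q) *L (u *L x)    ≈⟨ regroup y q u x ⟩
  ((q *L u) *L y) *L x    ≈⟨ *-cong (*-cong (≈sym (qp-suc l)) (rf y)) (rf x) ⟩
  (qp (suc l) *L y) *L x  ≈⟨ *-cong (qp-inverse (suc l)) (rf x) ⟩
  1L *L x                 ≈⟨ *-identityˡ x ⟩
  x                       ∎
  where
  u x y : Laurent
  u = qp l
  x = qpow (- (+ l))
  y = qpow (- (+ suc l))
  regroup : ∀ y q u x → (y *L q) *L (u *L x) ≈R ((q *L u) *L y) *L x
  regroup = solve 4 (λ y q u x → (y :* q) :* (u :* x) := ((q :* u) :* y) :* x) ≈refl

-- The sum defining ∇b(l) may be extended to i = l+1: that term contains (q^{-l})_{l+1} = 0.
nabla-extend : ∀ b l → sumL (nablaTerm b l) (suc l) ≈R nabla b l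
nabla-extend b l = ≈trans
  (+-cong (rf (nabla b l))
          (*-cong (*-cong (*-cong (rf (qp (suc l))) (poch-vanishes x l x-qp)) (rf (invPoch (suc l))))
                  (rf (fromPS (b (suc l))))))
  (drop-zero-term (nabla b l) (qp (suc l)) (invPoch (suc l)) (fromPS (b (suc l))))
  where
  x : Laurent
  x = qpow (- (+ l))
  x-qp : x *L qp l ≈R 1L
  x-qp = ≈trans (*-comm x (qp l)) (qp-inverse l)
  drop-zero-term : ∀ s P I' Bb → s +L ((P *L 0L) *L I') *L Bb ≈R s
  drop-zero-term = solve 4 (λ s P I' Bb → s :+ ((P :* con Q.0ℚ) :* I') :* Bb := s) ≈refl

-- Termwise form of (B): with x = q^{-l} and y = q^{-(l+1)}, the factors (x)_{i+1} and
-- (y)_{i+1} = (1 − y)(x)_i differ by a multiple of (x)_i, and after multiplying by q^l the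
-- remaining factor 1 − q^{i+1} cancels against 1/(q)_{i+1}.
nablaTerm-difference : ∀ b l i →
  qp l *L (nablaTerm b l (suc i) -L nablaTerm b (suc l) (suc i)) ≈R nablaTerm (λ j → b (suc j)) l i
nablaTerm-difference b l i = begin
  u *L (((qp (suc i) *L (Px *L (1L -L x *L qi))) *L I') *L Bb -L ((qp (suc i) *L poch y (suc i)) *L I') *L Bb)
    ≈⟨ *-cong (rf u) (+-cong (*-cong (*-cong (*-cong (qp-suc i) (rf (poch x (suc i)))) (rf I')) (rf Bb))
                             (-‿cong (*-cong (*-cong (*-cong (qp-suc i) y-poch) (rf I')) (rf Bb)))) ⟩
  u *L ((((q *L qi) *L (Px *L (1L -L x *L qi))) *L I') *L Bb -L (((q *L qi) *L ((1L -L y) *L Px)) *L I') *L Bb)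
    ≈⟨ collect u q qi Px x y I' Bb ⟩
  ((qi *L Px) *L Bb) *L (I' *L ((u *L (y *L q)) -L (u *L x) *L (q *L qi)))
    ≈⟨ *-cong (rf ((qi *L Px) *L Bb)) (*-cong (rf I') (+-cong uyq (-‿cong (*-cong ux (rf (q *L qi)))))) ⟩
  ((qi *L Px) *L Bb) *L (I' *L (1L -L 1L *L (q *L qi)))
    ≈⟨ *-cong (rf ((qi *L Px) *L Bb)) (*-cong (rf I') (+-cong (rf 1L) (-‿cong (*-identityˡ (q *L qi))))) ⟩
  ((qi *L Px) *L Bb) *L (I' *L (1L -L q *L qi))
    ≈⟨ *-cong (rf ((qi *L Px) *L Bb)) (invPoch-step i) ⟩
  ((qi *L Px) *L Bb) *L invPoch i
    ≈⟨ swap (qi *L Px) Bb (invPoch i) ⟩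
  ((qi *L Px) *L invPoch i) *L Bb ∎
  where
  u x y qi Px I' Bb : Laurent
  u  = qp l
  x  = qpow (- (+ l))
  y  = qpow (- (+ suc l))
  qi = qp i
  Px = poch x i
  I' = invPoch (suc i)
  Bb = fromPS (b (suc i))
  ux : u *L x ≈R 1L
  ux = qp-inverse l
  uyq : u *L (y *L q) ≈R 1L
  uyq = ≈trans (*-cong (rf u) (qpow-neg-suc l)) ux
  y-poch : poch y (suc i) ≈R (1L -L y) *L Px
  y-poch = ≈trans (poch-shift y i) (*-cong (rf (1L -L y)) (poch-cong (qpow-neg-suc l) i))
  collect : ∀ u q qi Px x y I' Bb →
    u *L ((((q *L qi) *L (Px *L (1L -L x *L qi))) *L I') *L Bb -L (((q *L qi) *L ((1L -L y) *L Px)) *L I') *L Bb)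
    ≈R ((qi *L Px) *L Bb) *L (I' *L ((u *L (y *L q)) -L (u *L x) *L (q *L qi)))
  collect = solve 8 (λ u q qi Px x y I' Bb →
    u :* ((((q :* qi) :* (Px :* (one :- x :* qi))) :* I') :* Bb :- (((q :* qi) :* ((one :- y) :* Px)) :* I') :* Bb)
    := ((qi :* Px) :* Bb) :* (I' :* ((u :* (y :* q)) :- (u :* x) :* (q :* qi)))) ≈refl
  swap : ∀ a b c → (a *L b) *L c ≈R (a *L c) *L b
  swap = solve 3 (λ a b c → (a :* b) :* c := (a :* c) :* b) ≈refl

-- Identity (B) itself: extend ∇b(l) to l+1 terms, cancel the common term i = 0 and apply
-- nablaTerm-difference to the rest.
nabla-step : ∀ b l → qp l *L (nabla b l -L nabla b (suc l)) ≈R nabla (λ j → b (suc j)) l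
nabla-step b l = begin
  u *L (nabla b l -L sumL (nablaTerm b (suc l)) (suc l))
    ≈⟨ *-cong (rf u) (+-cong (≈sym (nabla-extend b l)) (rf (-L nabla b (suc l)))) ⟩
  u *L (sumL (nablaTerm b l) (suc l) -L sumL (nablaTerm b (suc l)) (suc l))
    ≈⟨ *-cong (rf u) (+-cong (sumL-front (nablaTerm b l) l) (-‿cong (sumL-front (nablaTerm b (suc l)) l))) ⟩
  u *L ((T₀ +L X) -L (T₀ +L Y))
    ≈⟨ cancel u T₀ X Y ⟩
  u *L (X +L (-L Y))
    ≈⟨ *-cong (rf u) (≈sym (≈trans (sumL-+ (λ i → nablaTerm b l (suc i)) (λ i → -L nablaTerm b (suc l) (suc i)) l)
                                   (+-cong (rf X) (sumL-neg (λ i → nablaTerm b (suc l) (suc i)) l)))) ⟩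
  u *L sumL D l
    ≈⟨ ≈sym (sumL-scale u D l) ⟩
  sumL (λ i → u *L D i) l
    ≈⟨ sumL-cong (nablaTerm-difference b l) l ⟩
  nabla (λ j → b (suc j)) l ∎
  where
  u T₀ X Y : Laurent
  u  = qp l
  T₀ = nablaTerm b l 0
  X  = sumL (λ i → nablaTerm b l (suc i)) l
  Y  = sumL (λ i → nablaTerm b (suc l) (suc i)) l
  D : ℕ → Laurent
  D i = nablaTerm b l (suc i) -L nablaTerm b (suc l) (suc i)
  cancel : ∀ u A X Y → u *L ((A +L X) -L (A +L Y)) ≈R u *L (X +L (-L Y))
  cancel = solve 4 (λ u A X Y → u :* ((A :+ X) :- (A :+ Y)) := u :* (X :+ (:- Y))) ≈refl

Bsum-nabla : ∀ b m l → qp (l * m) *L Bsum (nabla b) m l ≈R nabla (λ j → b (j + m)) l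
Bsum-nabla b zero l = begin
  qp (l * 0) *L (nabla b (l + 0) *L (1L *L 1L))
    ≈⟨ *-cong (≈trans (≡⇒≈R (cong qp (NP.*-zeroʳ l))) qp-zero) (*-cong (≡⇒≈R (cong (nabla b) (NP.+-identityʳ l))) (rf (1L *L 1L))) ⟩
  1L *L (nabla b l *L (1L *L 1L))
    ≈⟨ drop-ones (nabla b l) ⟩
  nabla b l
    ≈⟨ nabla-cong b (λ j → b (j + 0)) (λ j → cong b (sym (NP.+-identityʳ j))) l ⟩
  nabla (λ j → b (j + 0)) l ∎
  where
  drop-ones : ∀ a → 1L *L (a *L (1L *L 1L)) ≈R a
  drop-ones = solve 1 (λ a → one :* (a :* (one :* one)) := a) ≈refl
Bsum-nabla b (suc m) l = begin
  qp (l * suc m) *L Bsum c (suc m) l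
    ≈⟨ *-cong (≈trans (≡⇒≈R (cong qp (NP.*-suc l m))) (qp-+ l (l * m))) (Bsum-step c m l) ⟩
  (qp l *L qp (l * m)) *L (Bsum c m l -L qp m *L Bsum c m (suc l))
    ≈⟨ regroup (qp l) (qp (l * m)) (qp m) (Bsum c m l) (Bsum c m (suc l)) ⟩
  qp l *L (qp (l * m) *L Bsum c m l -L (qp m *L qp (l * m)) *L Bsum c m (suc l))
    ≈⟨ *-cong (rf (qp l)) (+-cong (Bsum-nabla b m l)
         (-‿cong (≈trans (*-cong (≈sym (qp-+ m (l * m))) (rf (Bsum c m (suc l)))) (Bsum-nabla b m (suc l))))) ⟩
  qp l *L (nabla b' l -L nabla b' (suc l))
    ≈⟨ nabla-step b' l ⟩
  nabla (λ j → b (suc j + m)) l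
    ≈⟨ nabla-cong (λ j → b (suc j + m)) (λ j → b (j + suc m)) (λ j → cong b (sym (NP.+-suc j m))) l ⟩
  nabla (λ j → b (j + suc m)) l ∎
  where
  c : ℕ → Laurent
  c = nabla b
  b' : ℕ → PS
  b' j = b (j + m)
  regroup : ∀ a b w s t → (a *L b) *L (s -L w *L t) ≈R a *L (b *L s -L (w *L b) *L t)
  regroup = solve 5 (λ a b w s t → (a :* b) :* (s :- w :* t) := a :* (b :* s :- (w :* b) :* t)) ≈refl

Bsum-nabla-divided : ∀ b m l → Bsum (nabla b) m l ≈R qpow (- (+ (l * m))) *L nabla (λ j → b (j + m)) l
Bsum-nabla-divided b m l = begin
  Bsum (nabla b) m l                          ≈⟨ ≈sym (*-identityˡ (Bsum (nabla b) m l)) ⟩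
  1L *L Bsum (nabla b) m l                    ≈⟨ *-cong (≈sym inverse) (rf (Bsum (nabla b) m l)) ⟩
  (q⁻ᴺ *L qp (l * m)) *L Bsum (nabla b) m l   ≈⟨ *-assoc q⁻ᴺ (qp (l * m)) (Bsum (nabla b) m l) ⟩
  q⁻ᴺ *L (qp (l * m) *L Bsum (nabla b) m l)   ≈⟨ *-cong (rf q⁻ᴺ) (Bsum-nabla b m l) ⟩
  q⁻ᴺ *L nabla (λ j → b (j + m)) l            ∎
  where
  q⁻ᴺ : Laurent
  q⁻ᴺ = qpow (- (+ (l * m)))
  inverse : q⁻ᴺ *L qp (l * m) ≈R 1L
  inverse = ≈trans (*-comm q⁻ᴺ (qp (l * m))) (qp-inverse (l * m))

nabla-zero : ∀ b → nabla b 0 ≈R fromPS (b 0)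
nabla-zero b = ≈trans (*-cong (*-cong (*-cong qp-zero (rf 1L)) (rf 1L)) (rf (fromPS (b 0)))) (drop-ones (fromPS (b 0)))
  where
  drop-ones : ∀ a → (1L *L 1L *L 1L) *L a ≈R a
  drop-ones = solve 1 (λ a → (one :* one :* one) :* a := a) ≈refl

proposition3p1 : (b : ℕ → PS) (m l : ℕ) →
    (sumL (λ n → nabla b (l + n) *L B n (qpow (+ m))) m
      ≈L qpow (- (+ (l * m)))
         *L sumL (λ j → qpow (+ j) *L poch (qpow (- (+ l))) j
                          *L fromPS (invqPoch j) *L fromPS (b (j + m))) l)
    × (sumL (λ n → nabla b n *L B n (qpow (+ m))) m ≈L fromPS (b m))
proposition3p1 b m l = getR (Bsum-nabla-divided b m l) , getR special-case
  where
  special-case : Bsum (nabla b) m 0 ≈R fromPS (b m)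
  special-case = ≈trans (Bsum-nabla-divided b m 0)
    (≈trans (*-cong qp-zero (nabla-zero (λ j → b (j + m)))) (*-identityˡ (fromPS (b m))))
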